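{- Let $p$ be a predicate of arbitrary arity, let $F=F[p]$ be a formula, and let $V,W,A$ be formulas such that $\mathrm{SUBST}(V,p,F)$, $\mathrm{SUBST}(W,p,F)$, $\mathrm{SUBST}(A,p,F)$ and $\mathrm{free}(A)\cap\mathcal X=\emptyset$. Then \[F[(A\wedge V)\vee(\neg A\wedge W)]\equiv(A\wedge F[V])\vee(\neg A\wedge F[W]).\]
   Context: Formulas are those of first-order logic with equality extended by second-order quantification over predicates. $\mathrm{free}(F)$ is the set of symbols occurring free in $F$; $\equiv$ denotes logical equivalence. $\mathcal X=\{x_1,x_2,\dots\}$ is a fixed set of distinguished individual symbols. Substitution: for a predicate $p$ of arity $k$, a formula $F=F[p]$ and a formula $G$, $F[G]$ is $F$ with each atom occurrence $p(t_1,\dots,t_k)$ with $p$ free in $F$ replaced by $G$ with free occurrences of $x_1,\dots,x_k$ replaced by $t_1,\dots,t_k$. $\mathrm{SUBST}(G,p,F)$ holds iff (i) no free occurrence of $p$ in $F$ is in the scope of a quantifier binding a member of $\mathrm{free}(G)$; (ii) $p\notin\mathrm{free}(G)$; (iii) $\mathrm{free}(G)\cap\{x_j: j>k\}=\emptyset$. -}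

module Defs where

open import Level using (Lift) renaming (suc to lsuc; zero to lzero)
open import Data.Nat using (ℕ; zero; suc; _≤_; _<?_)
open import Data.Nat.Properties using () renaming (_≟_ to _≟ℕ_)
open import Data.Fin using (fromℕ<)
open import Data.Vec using (Vec; []; _∷_; lookup)
open import Data.Product using (Σ; _×_; _,_)
open import Data.Sum using (_⊎_)
open import Data.Unit using (⊤)
open import Relation.Nullary using (¬_; Dec; yes; no)
open import Relation.Binary.PropositionalEquality using (_≡_; refl)
open import Function.Bundles using (_⇔_)

-- Individual symbols.  xs j is the distinguished symbol x_{j+1}
-- (0-based indexing), so 𝒳 = { xs j | j ∈ ℕ }; cs i are the other
-- individual symbols.
data ISym : Set where
  xs : ℕ → ISym
  cs : ℕ → ISym

record PSym : Set where
  constructor psym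
  field
    name  : ℕ
    arity : ℕ
open PSym public

_≟I_ : (a b : ISym) → Dec (a ≡ b)
xs i ≟I xs j with i ≟ℕ j
... | yes refl = yes refl
... | no ne = no λ { refl → ne refl }
xs _ ≟I cs _ = no λ ()
cs _ ≟I xs _ = no λ ()
cs i ≟I cs j with i ≟ℕ j
... | yes refl = yes refl
... | no ne = no λ { refl → ne refl }

_≟P_ : (p q : PSym) → Dec (p ≡ q)
psym a b ≟P psym c d with a ≟ℕ c | b ≟ℕ d
... | yes refl | yes refl = yes refl
... | no ne | _ = no λ { refl → ne refl }
... | yes _ | no ne = no λ { refl → ne refl }

data Term : Set where
  var : ISym → Term
  fun : (f : ℕ) {n : ℕ} → Vec Term n → Term

infixr 6 _∧ᶠ_
infixr 5 _∨ᶠ_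
infixr 4 _⇒ᶠ_
infix 7 ¬ᶠ_
infix 8 _≐_

data Form : Set where
  ⊤ᶠ ⊥ᶠ : Form
  atom  : (q : PSym) → Vec Term (arity q) → Form
  _≐_   : Term → Term → Form
  ¬ᶠ_   : Form → Form
  _∧ᶠ_ _∨ᶠ_ _⇒ᶠ_ : Form → Form → Form
  ∀ᵢ ∃ᵢ : ISym → Form → Form
  ∀ₚ ∃ₚ : PSym → Form → Form

mutual
  data FreeIT (y : ISym) : Term → Set where
    here : FreeIT y (var y)
    arg  : ∀ {f n} {ts : Vec Term n} → FreeITs y ts → FreeIT y (fun f ts)

  data FreeITs (y : ISym) : ∀ {n} → Vec Term n → Set where
    hd : ∀ {n t} {ts : Vec Term n} → FreeIT y t → FreeITs y (t ∷ ts)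
    tl : ∀ {n t} {ts : Vec Term n} → FreeITs y ts → FreeITs y (t ∷ ts)

data FreeI (y : ISym) : Form → Set where
  atom : ∀ {q ts} → FreeITs y ts → FreeI y (atom q ts)
  eqˡ  : ∀ {t u} → FreeIT y t → FreeI y (t ≐ u)
  eqʳ  : ∀ {t u} → FreeIT y u → FreeI y (t ≐ u)
  neg  : ∀ {F} → FreeI y F → FreeI y (¬ᶠ F)
  andˡ : ∀ {F G} → FreeI y F → FreeI y (F ∧ᶠ G)
  andʳ : ∀ {F G} → FreeI y G → FreeI y (F ∧ᶠ G)
  orˡ  : ∀ {F G} → FreeI y F → FreeI y (F ∨ᶠ G)
  orʳ  : ∀ {F G} → FreeI y G → FreeI y (F ∨ᶠ G)
  impˡ : ∀ {F G} → FreeI y F → FreeI y (F ⇒ᶠ G)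
  impʳ : ∀ {F G} → FreeI y G → FreeI y (F ⇒ᶠ G)
  allᵢ : ∀ {z F} → ¬ (z ≡ y) → FreeI y F → FreeI y (∀ᵢ z F)
  exᵢ  : ∀ {z F} → ¬ (z ≡ y) → FreeI y F → FreeI y (∃ᵢ z F)
  allₚ : ∀ {q F} → FreeI y F → FreeI y (∀ₚ q F)
  exₚ  : ∀ {q F} → FreeI y F → FreeI y (∃ₚ q F)

data FreeP (p : PSym) : Form → Set where
  atom : ∀ {ts} → FreeP p (atom p ts)
  neg  : ∀ {F} → FreeP p F → FreeP p (¬ᶠ F)
  andˡ : ∀ {F G} → FreeP p F → FreeP p (F ∧ᶠ G)
  andʳ : ∀ {F G} → FreeP p G → FreeP p (F ∧ᶠ G)
  orˡ  : ∀ {F G} → FreeP p F → FreeP p (F ∨ᶠ G)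
  orʳ  : ∀ {F G} → FreeP p G → FreeP p (F ∨ᶠ G)
  impˡ : ∀ {F G} → FreeP p F → FreeP p (F ⇒ᶠ G)
  impʳ : ∀ {F G} → FreeP p G → FreeP p (F ⇒ᶠ G)
  allᵢ : ∀ {z F} → FreeP p F → FreeP p (∀ᵢ z F)
  exᵢ  : ∀ {z F} → FreeP p F → FreeP p (∃ᵢ z F)
  allₚ : ∀ {q F} → ¬ (q ≡ p) → FreeP p F → FreeP p (∀ₚ q F)
  exₚ  : ∀ {q F} → ¬ (q ≡ p) → FreeP p F → FreeP p (∃ₚ q F)

-- Condition (i) of SUBST: no free occurrence of p in F lies in the
-- scope of a quantifier binding a member of free(G).

NoCapture : Form → PSym → Form → Set
NoCapture G p ⊤ᶠ = ⊤
NoCapture G p ⊥ᶠ = ⊤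
NoCapture G p (atom q ts) = ⊤
NoCapture G p (t ≐ u) = ⊤
NoCapture G p (¬ᶠ F) = NoCapture G p F
NoCapture G p (F ∧ᶠ H) = NoCapture G p F × NoCapture G p H
NoCapture G p (F ∨ᶠ H) = NoCapture G p F × NoCapture G p H
NoCapture G p (F ⇒ᶠ H) = NoCapture G p F × NoCapture G p H
NoCapture G p (∀ᵢ y F) = (FreeP p F → ¬ FreeI y G) × NoCapture G p F
NoCapture G p (∃ᵢ y F) = (FreeP p F → ¬ FreeI y G) × NoCapture G p F
NoCapture G p (∀ₚ q F) with q ≟P p
... | yes _ = ⊤
... | no _ = (FreeP p F → ¬ FreeP q G) × NoCapture G p F
NoCapture G p (∃ₚ q F) with q ≟P p
... | yes _ = ⊤
... | no _ = (FreeP p F → ¬ FreeP q G) × NoCapture G p F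

-- SUBST(G, p, F)   (recall: xs j is x_{j+1}, so "j+1 > k" is "k ≤ j")
SUBST : Form → PSym → Form → Set
SUBST G p F =
  NoCapture G p F
  × ¬ FreeP p G
  × (∀ j → arity p ≤ j → ¬ FreeI (xs j) G)

-- Literal replacement of free occurrences of individual symbols by terms.
Sub : Set
Sub = ISym → Term

_[_↦_]ˢ : Sub → ISym → Term → Sub
(σ [ y ↦ t ]ˢ) z with z ≟I y
... | yes _ = t
... | no _ = σ z

mutual
  substT : Sub → Term → Term
  substT σ (var y) = σ y
  substT σ (fun f ts) = fun f (substTs σ ts)

  substTs : ∀ {n} → Sub → Vec Term n → Vec Term n
  substTs σ [] = []
  substTs σ (t ∷ ts) = substT σ t ∷ substTs σ ts

substF : Sub → Form → Form
substF σ ⊤ᶠ = ⊤ᶠ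
substF σ ⊥ᶠ = ⊥ᶠ
substF σ (atom q ts) = atom q (substTs σ ts)
substF σ (t ≐ u) = substT σ t ≐ substT σ u
substF σ (¬ᶠ F) = ¬ᶠ substF σ F
substF σ (F ∧ᶠ G) = substF σ F ∧ᶠ substF σ G
substF σ (F ∨ᶠ G) = substF σ F ∨ᶠ substF σ G
substF σ (F ⇒ᶠ G) = substF σ F ⇒ᶠ substF σ G
substF σ (∀ᵢ y F) = ∀ᵢ y (substF (σ [ y ↦ var y ]ˢ) F)
substF σ (∃ᵢ y F) = ∃ᵢ y (substF (σ [ y ↦ var y ]ˢ) F)
substF σ (∀ₚ q F) = ∀ₚ q (substF σ F)
substF σ (∃ₚ q F) = ∃ₚ q (substF σ F)

instSub : ∀ {k} → Vec Term k → Sub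
instSub {k} ts (xs j) with j <? k
... | yes j<k = lookup ts (fromℕ< j<k)
... | no _ = var (xs j)
instSub ts (cs i) = var (cs i)

_[_≔_] : Form → PSym → Form → Form
⊤ᶠ [ p ≔ G ] = ⊤ᶠ
⊥ᶠ [ p ≔ G ] = ⊥ᶠ
atom q ts [ p ≔ G ] with q ≟P p
... | yes _ = substF (instSub ts) G
... | no _ = atom q ts
(t ≐ u) [ p ≔ G ] = t ≐ u
(¬ᶠ F) [ p ≔ G ] = ¬ᶠ (F [ p ≔ G ])
(F ∧ᶠ H) [ p ≔ G ] = (F [ p ≔ G ]) ∧ᶠ (H [ p ≔ G ])
(F ∨ᶠ H) [ p ≔ G ] = (F [ p ≔ G ]) ∨ᶠ (H [ p ≔ G ])
(F ⇒ᶠ H) [ p ≔ G ] = (F [ p ≔ G ]) ⇒ᶠ (H [ p ≔ G ])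
∀ᵢ y F [ p ≔ G ] = ∀ᵢ y (F [ p ≔ G ])
∃ᵢ y F [ p ≔ G ] = ∃ᵢ y (F [ p ≔ G ])
∀ₚ q F [ p ≔ G ] with q ≟P p
... | yes _ = ∀ₚ q F
... | no _ = ∀ₚ q (F [ p ≔ G ])
∃ₚ q F [ p ≔ G ] with q ≟P p
... | yes _ = ∃ₚ q F
... | no _ = ∃ₚ q (F [ p ≔ G ])

record Interp (D : Set) : Set₁ where
  field
    ival : ISym → D
    fval : ℕ → {n : ℕ} → Vec D n → D
    pval : (q : PSym) → Vec D (arity q) → Set
open Interp public

_[_↦ᵢ_] : ∀ {D} → Interp D → ISym → D → Interp D
ival (I [ y ↦ᵢ d ]) z with z ≟I y
... | yes _ = d
... | no _ = ival I z
fval (I [ y ↦ᵢ d ]) = fval I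
pval (I [ y ↦ᵢ d ]) = pval I

_[_↦ₚ_] : ∀ {D} → (I : Interp D) (q : PSym) → (Vec D (arity q) → Set) → Interp D
ival (I [ q ↦ₚ R ]) = ival I
fval (I [ q ↦ₚ R ]) = fval I
pval (I [ q ↦ₚ R ]) r with r ≟P q
... | yes refl = R
... | no _ = pval I r

mutual
  evalT : ∀ {D} → Interp D → Term → D
  evalT I (var y) = ival I y
  evalT I (fun f ts) = fval I f (evalTs I ts)

  evalTs : ∀ {D n} → Interp D → Vec Term n → Vec D n
  evalTs I [] = []
  evalTs I (t ∷ ts) = evalT I t ∷ evalTs I ts

_⊨_ : ∀ {D} → Interp D → Form → Set₁
I ⊨ ⊤ᶠ = Lift (lsuc lzero) ⊤
I ⊨ ⊥ᶠ = Lift (lsuc lzero) Data.Empty.⊥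
  where import Data.Empty
I ⊨ atom q ts = Lift (lsuc lzero) (pval I q (evalTs I ts))
I ⊨ (t ≐ u) = Lift (lsuc lzero) (evalT I t ≡ evalT I u)
I ⊨ (¬ᶠ F) = ¬ (I ⊨ F)
I ⊨ (F ∧ᶠ G) = (I ⊨ F) × (I ⊨ G)
I ⊨ (F ∨ᶠ G) = (I ⊨ F) ⊎ (I ⊨ G)
I ⊨ (F ⇒ᶠ G) = (I ⊨ F) → (I ⊨ G)
_⊨_ {D} I (∀ᵢ y F) = (d : D) → (I [ y ↦ᵢ d ]) ⊨ F
_⊨_ {D} I (∃ᵢ y F) = Σ D λ d → (I [ y ↦ᵢ d ]) ⊨ F
_⊨_ {D} I (∀ₚ q F) = (R : Vec D (arity q) → Set) → (I [ q ↦ₚ R ]) ⊨ F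
_⊨_ {D} I (∃ₚ q F) = Σ (Vec D (arity q) → Set) λ R → (I [ q ↦ₚ R ]) ⊨ F

infix 2 _≣_
_≣_ : Form → Form → Set₁
F ≣ G = ∀ {D : Set} (I : Interp D) → (I ⊨ F) ⇔ (I ⊨ G)

-- In a fixed interpretation I, the formula A has a definite truth value (by
-- excluded middle), so (A ∧ V) ∨ (¬ A ∧ W) behaves there exactly like V or
-- like W.  The replacement theorem turns this into F[(A ∧ V) ∨ (¬ A ∧ W)] ⇔
-- F[V] (resp. F[W]) at I: while descending through F towards the occurrences
-- of p, the interpretation is only updated at symbols bound in F, which by the
-- capture condition SUBST(A, p, F) are not free in A, so the truth value of A
-- is preserved.  Since no x_j is free in A, instantiating the arguments of p
-- leaves A untouched.
module Submission where

open import Defs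
open import Level using (Level) renaming (suc to lsuc; zero to lzero)
open import Data.Empty using (⊥-elim)
open import Data.Product using (Σ; _×_; _,_; proj₁; proj₂)
open import Data.Product.Function.NonDependent.Propositional using (_×-⇔_)
open import Data.Sum using (_⊎_; inj₁; inj₂)
open import Data.Sum.Function.Propositional using (_⊎-⇔_)
open import Data.Vec using (Vec; []; _∷_)
open import Function using (_∘_; _$_)
open import Function.Bundles using (_⇔_; mk⇔; Equivalence)
open import Function.Construct.Identity using (⇔-id)
open import Function.Construct.Symmetry using (⇔-sym)
open import Function.Construct.Composition using (_⇔-∘_)
open import Function.Related.TypeIsomorphisms using (→-cong-⇔; ¬-cong-⇔)
open import Relation.Nullary using (¬_; yes; no)
open import Relation.Binary.PropositionalEquality using (_≡_; refl; sym; trans; cong; cong₂)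
open import Axiom.ExcludedMiddle using (ExcludedMiddle)

open Equivalence using (to; from)

private
  variable
    a b : Level
    D : Set

Π-cong-⇔ : {X : Set a} {P Q : X → Set b} → (∀ x → P x ⇔ Q x) → ((x : X) → P x) ⇔ ((x : X) → Q x)
Π-cong-⇔ P⇔Q = mk⇔ (λ h x → to (P⇔Q x) (h x)) (λ h x → from (P⇔Q x) (h x))

Σ-cong-⇔ : {X : Set a} {P Q : X → Set b} → (∀ x → P x ⇔ Q x) → Σ X P ⇔ Σ X Q
Σ-cong-⇔ P⇔Q = mk⇔ (λ { (x , h) → x , to (P⇔Q x) h }) (λ { (x , h) → x , from (P⇔Q x) h })

≡⇒⇔ : {X Y : Set a} → X ≡ Y → X ⇔ Y
≡⇒⇔ refl = ⇔-id _

if-true-⇔ : {X Y Z : Set a} → X → ((X × Y) ⊎ (¬ X × Z)) ⇔ Y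
if-true-⇔ x = mk⇔ (λ { (inj₁ (_ , y)) → y ; (inj₂ (¬x , _)) → ⊥-elim (¬x x) }) (λ y → inj₁ (x , y))

if-false-⇔ : {X Y Z : Set a} → ¬ X → ((X × Y) ⊎ (¬ X × Z)) ⇔ Z
if-false-⇔ ¬x = mk⇔ (λ { (inj₁ (x , _)) → ⊥-elim (¬x x) ; (inj₂ (_ , z)) → z }) (λ z → inj₂ (¬x , z))

record Agree (B : Form) (I J : Interp D) : Set₁ where
  field
    ival-agree : ∀ {y} → FreeI y B → ival I y ≡ ival J y
    fval-agree : ∀ f {n} (vs : Vec D n) → fval I f vs ≡ fval J f vs
    pval-agree : ∀ {q} → FreeP q B → pval I q ≡ pval J q
open Agree

agree-restrict : ∀ {B C} {I J : Interp D} →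
  (∀ {y} → FreeI y B → FreeI y C) → (∀ {q} → FreeP q B → FreeP q C) →
  Agree C I J → Agree B I J
agree-restrict B⊆C B⊆Cₚ ag = record
  { ival-agree = ival-agree ag ∘ B⊆C
  ; fval-agree = fval-agree ag
  ; pval-agree = pval-agree ag ∘ B⊆Cₚ
  }

agree-underᵢ : ∀ {B C y d} {I J : Interp D} →
  (∀ {z} → ¬ y ≡ z → FreeI z B → FreeI z C) → (∀ {q} → FreeP q B → FreeP q C) →
  Agree C I J → Agree B (I [ y ↦ᵢ d ]) (J [ y ↦ᵢ d ])
agree-underᵢ {y = y} {d} {I} {J} B⊆C B⊆Cₚ ag = record
  { ival-agree = ival-underᵢ
  ; fval-agree = fval-agree ag
  ; pval-agree = pval-agree ag ∘ B⊆Cₚ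
  }
  where
  ival-underᵢ : ∀ {z} → FreeI z _ → ival (I [ y ↦ᵢ d ]) z ≡ ival (J [ y ↦ᵢ d ]) z
  ival-underᵢ {z} z∈B with z ≟I y
  ... | yes _ = refl
  ... | no z≢y = ival-agree ag (B⊆C (z≢y ∘ sym) z∈B)

agree-underₚ : ∀ {B C q R} {I J : Interp D} →
  (∀ {y} → FreeI y B → FreeI y C) → (∀ {r} → ¬ q ≡ r → FreeP r B → FreeP r C) →
  Agree C I J → Agree B (I [ q ↦ₚ R ]) (J [ q ↦ₚ R ])
agree-underₚ {q = q} {R} {I} {J} B⊆C B⊆Cₚ ag = record
  { ival-agree = ival-agree ag ∘ B⊆C
  ; fval-agree = fval-agree ag
  ; pval-agree = pval-underₚ
  }
  where
  pval-underₚ : ∀ {r} → FreeP r _ → pval (I [ q ↦ₚ R ]) r ≡ pval (J [ q ↦ₚ R ]) r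
  pval-underₚ {r} r∈B with r ≟P q
  ... | yes refl = refl
  ... | no r≢q = pval-agree ag (B⊆Cₚ (r≢q ∘ sym) r∈B)

agree-freshᵢ : ∀ {B y d} {J : Interp D} → ¬ FreeI y B → Agree B (J [ y ↦ᵢ d ]) J
agree-freshᵢ {y = y} {d} {J} y∉B = record
  { ival-agree = ival-freshᵢ
  ; fval-agree = λ _ _ → refl
  ; pval-agree = λ _ → refl
  }
  where
  ival-freshᵢ : ∀ {z} → FreeI z _ → ival (J [ y ↦ᵢ d ]) z ≡ ival J z
  ival-freshᵢ {z} z∈B with z ≟I y
  ... | yes refl = ⊥-elim (y∉B z∈B)
  ... | no _ = refl

agree-freshₚ : ∀ {B q R} {J : Interp D} → ¬ FreeP q B → Agree B (J [ q ↦ₚ R ]) J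
agree-freshₚ {q = q} {R} {J} q∉B = record
  { ival-agree = λ _ → refl
  ; fval-agree = λ _ _ → refl
  ; pval-agree = pval-freshₚ
  }
  where
  pval-freshₚ : ∀ {r} → FreeP r _ → pval (J [ q ↦ₚ R ]) r ≡ pval J r
  pval-freshₚ {r} r∈B with r ≟P q
  ... | yes refl = ⊥-elim (q∉B r∈B)
  ... | no _ = refl

mutual
  evalT-coincidence : ∀ {I J : Interp D} t →
    (∀ {y} → FreeIT y t → ival I y ≡ ival J y) →
    (∀ f {n} (vs : Vec D n) → fval I f vs ≡ fval J f vs) →
    evalT I t ≡ evalT J t
  evalT-coincidence (var y) agᵢ agf = agᵢ here
  evalT-coincidence {I = I} (fun f ts) agᵢ agf =
    trans (cong (fval I f) (evalTs-coincidence ts (agᵢ ∘ arg) agf)) (agf f _)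

  evalTs-coincidence : ∀ {n} {I J : Interp D} (ts : Vec Term n) →
    (∀ {y} → FreeITs y ts → ival I y ≡ ival J y) →
    (∀ f {n} (vs : Vec D n) → fval I f vs ≡ fval J f vs) →
    evalTs I ts ≡ evalTs J ts
  evalTs-coincidence [] agᵢ agf = refl
  evalTs-coincidence (t ∷ ts) agᵢ agf =
    cong₂ _∷_ (evalT-coincidence t (agᵢ ∘ hd) agf) (evalTs-coincidence ts (agᵢ ∘ tl) agf)

⊨-coincidence : ∀ B {I J : Interp D} → Agree B I J → (I ⊨ B) ⇔ (J ⊨ B)
⊨-coincidence ⊤ᶠ ag = ⇔-id _
⊨-coincidence ⊥ᶠ ag = ⇔-id _
⊨-coincidence (atom q ts) ag = ≡⇒⇔ (cong (Level.Lift _) (cong₂ _$_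
  (pval-agree ag atom)
  (evalTs-coincidence ts (ival-agree ag ∘ atom) (fval-agree ag))))
⊨-coincidence (t ≐ u) ag = ≡⇒⇔ (cong (Level.Lift _) (cong₂ _≡_
  (evalT-coincidence t (ival-agree ag ∘ eqˡ) (fval-agree ag))
  (evalT-coincidence u (ival-agree ag ∘ eqʳ) (fval-agree ag))))
⊨-coincidence (¬ᶠ B) ag = ¬-cong-⇔ (⊨-coincidence B (agree-restrict neg neg ag))
⊨-coincidence (B ∧ᶠ C) ag =
  ⊨-coincidence B (agree-restrict andˡ andˡ ag) ×-⇔ ⊨-coincidence C (agree-restrict andʳ andʳ ag)
⊨-coincidence (B ∨ᶠ C) ag =
  ⊨-coincidence B (agree-restrict orˡ orˡ ag) ⊎-⇔ ⊨-coincidence C (agree-restrict orʳ orʳ ag)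
⊨-coincidence (B ⇒ᶠ C) ag =
  →-cong-⇔ (⊨-coincidence B (agree-restrict impˡ impˡ ag)) (⊨-coincidence C (agree-restrict impʳ impʳ ag))
⊨-coincidence (∀ᵢ y B) ag = Π-cong-⇔ λ d → ⊨-coincidence B (agree-underᵢ allᵢ allᵢ ag)
⊨-coincidence (∃ᵢ y B) ag = Σ-cong-⇔ λ d → ⊨-coincidence B (agree-underᵢ exᵢ exᵢ ag)
⊨-coincidence (∀ₚ q B) ag = Π-cong-⇔ λ R → ⊨-coincidence B (agree-underₚ allₚ allₚ ag)
⊨-coincidence (∃ₚ q B) ag = Σ-cong-⇔ λ R → ⊨-coincidence B (agree-underₚ exₚ exₚ ag)

⊨-freshᵢ : ∀ B {y d} {J : Interp D} → ¬ FreeI y B → ((J [ y ↦ᵢ d ]) ⊨ B) ⇔ (J ⊨ B)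
⊨-freshᵢ B y∉B = ⊨-coincidence B (agree-freshᵢ y∉B)

⊨-freshₚ : ∀ B {q R} {J : Interp D} → ¬ FreeP q B → ((J [ q ↦ₚ R ]) ⊨ B) ⇔ (J ⊨ B)
⊨-freshₚ B q∉B = ⊨-coincidence B (agree-freshₚ q∉B)

mutual
  substT-id : ∀ {σ} t → (∀ {y} → FreeIT y t → σ y ≡ var y) → substT σ t ≡ t
  substT-id (var y) σ-id = σ-id here
  substT-id (fun f ts) σ-id = cong (fun f) (substTs-id ts (σ-id ∘ arg))

  substTs-id : ∀ {n σ} (ts : Vec Term n) → (∀ {y} → FreeITs y ts → σ y ≡ var y) → substTs σ ts ≡ ts
  substTs-id [] σ-id = refl
  substTs-id (t ∷ ts) σ-id = cong₂ _∷_ (substT-id t (σ-id ∘ hd)) (substTs-id ts (σ-id ∘ tl))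

extendˢ-id : ∀ {σ B C y} → (∀ {z} → FreeI z C → σ z ≡ var z) →
  (∀ {z} → ¬ y ≡ z → FreeI z B → FreeI z C) →
  ∀ {z} → FreeI z B → (σ [ y ↦ var y ]ˢ) z ≡ var z
extendˢ-id {y = y} σ-id B⊆C {z} z∈B with z ≟I y
... | yes refl = refl
... | no z≢y = σ-id (B⊆C (z≢y ∘ sym) z∈B)

substF-id : ∀ {σ} B → (∀ {y} → FreeI y B → σ y ≡ var y) → substF σ B ≡ B
substF-id ⊤ᶠ σ-id = refl
substF-id ⊥ᶠ σ-id = refl
substF-id (atom q ts) σ-id = cong (atom q) (substTs-id ts (σ-id ∘ atom))
substF-id (t ≐ u) σ-id = cong₂ _≐_ (substT-id t (σ-id ∘ eqˡ)) (substT-id u (σ-id ∘ eqʳ))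
substF-id (¬ᶠ B) σ-id = cong ¬ᶠ_ (substF-id B (σ-id ∘ neg))
substF-id (B ∧ᶠ C) σ-id = cong₂ _∧ᶠ_ (substF-id B (σ-id ∘ andˡ)) (substF-id C (σ-id ∘ andʳ))
substF-id (B ∨ᶠ C) σ-id = cong₂ _∨ᶠ_ (substF-id B (σ-id ∘ orˡ)) (substF-id C (σ-id ∘ orʳ))
substF-id (B ⇒ᶠ C) σ-id = cong₂ _⇒ᶠ_ (substF-id B (σ-id ∘ impˡ)) (substF-id C (σ-id ∘ impʳ))
substF-id (∀ᵢ y B) σ-id = cong (∀ᵢ y) (substF-id B (extendˢ-id σ-id allᵢ))
substF-id (∃ᵢ y B) σ-id = cong (∃ᵢ y) (substF-id B (extendˢ-id σ-id exᵢ))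
substF-id (∀ₚ q B) σ-id = cong (∀ₚ q) (substF-id B (σ-id ∘ allₚ))
substF-id (∃ₚ q B) σ-id = cong (∃ₚ q) (substF-id B (σ-id ∘ exₚ))

instSub-id : ∀ {k} (ts : Vec Term k) B → (∀ j → ¬ FreeI (xs j) B) → substF (instSub ts) B ≡ B
instSub-id ts B xs∉B = substF-id B instSub-fixes
  where
  instSub-fixes : ∀ {y} → FreeI y B → instSub ts y ≡ var y
  instSub-fixes {xs j} xj∈B = ⊥-elim (xs∉B j xj∈B)
  instSub-fixes {cs i} _ = refl

module Replacement (p : PSym) (A G₁ G₂ : Form) {D : Set} (X : Set₁)
  (G₁⇔G₂ : ∀ {K : Interp D} (ts : Vec Term (arity p)) → (K ⊨ A) ⇔ X →
           (K ⊨ substF (instSub ts) G₁) ⇔ (K ⊨ substF (instSub ts) G₂)) where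

  replace : ∀ F {J : Interp D} → NoCapture A p F → (FreeP p F → (J ⊨ A) ⇔ X) →
            (J ⊨ (F [ p ≔ G₁ ])) ⇔ (J ⊨ (F [ p ≔ G₂ ]))
  replace ⊤ᶠ nc A⇔X = ⇔-id _
  replace ⊥ᶠ nc A⇔X = ⇔-id _
  replace (atom q ts) nc A⇔X with q ≟P p
  ... | yes refl = G₁⇔G₂ ts (A⇔X atom)
  ... | no _ = ⇔-id _
  replace (t ≐ u) nc A⇔X = ⇔-id _
  replace (¬ᶠ B) nc A⇔X = ¬-cong-⇔ (replace B nc (A⇔X ∘ neg))
  replace (B ∧ᶠ C) (ncB , ncC) A⇔X = replace B ncB (A⇔X ∘ andˡ) ×-⇔ replace C ncC (A⇔X ∘ andʳ)
  replace (B ∨ᶠ C) (ncB , ncC) A⇔X = replace B ncB (A⇔X ∘ orˡ) ⊎-⇔ replace C ncC (A⇔X ∘ orʳ)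
  replace (B ⇒ᶠ C) (ncB , ncC) A⇔X = →-cong-⇔ (replace B ncB (A⇔X ∘ impˡ)) (replace C ncC (A⇔X ∘ impʳ))
  replace (∀ᵢ y B) (y∉A , nc) A⇔X = Π-cong-⇔ λ d →
    replace B nc λ p∈B → A⇔X (allᵢ p∈B) ⇔-∘ ⊨-freshᵢ A (y∉A p∈B)
  replace (∃ᵢ y B) (y∉A , nc) A⇔X = Σ-cong-⇔ λ d →
    replace B nc λ p∈B → A⇔X (exᵢ p∈B) ⇔-∘ ⊨-freshᵢ A (y∉A p∈B)
  replace (∀ₚ q B) nc A⇔X with q ≟P p
  ... | yes _ = ⇔-id _
  ... | no q≢p = Π-cong-⇔ λ R →
    replace B (proj₂ nc) λ p∈B → A⇔X (allₚ q≢p p∈B) ⇔-∘ ⊨-freshₚ A (proj₁ nc p∈B)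
  replace (∃ₚ q B) nc A⇔X with q ≟P p
  ... | yes _ = ⇔-id _
  ... | no q≢p = Σ-cong-⇔ λ R →
    replace B (proj₂ nc) λ p∈B → A⇔X (exₚ q≢p p∈B) ⇔-∘ ⊨-freshₚ A (proj₁ nc p∈B)

⊨-instSub-if : ∀ {k} (ts : Vec Term k) A V W → (∀ j → ¬ FreeI (xs j) A) → (K : Interp D) →
  (K ⊨ substF (instSub ts) ((A ∧ᶠ V) ∨ᶠ ((¬ᶠ A) ∧ᶠ W))) ⇔
  (((K ⊨ A) × (K ⊨ substF (instSub ts) V)) ⊎ (¬ (K ⊨ A) × (K ⊨ substF (instSub ts) W)))
⊨-instSub-if ts A V W xs∉A K rewrite instSub-id ts A xs∉A = ⇔-id _

-- Capture inside V or W happens identically on both sides, so only the capture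
-- condition of SUBST(A, p, F) is used.
proposition14 : ExcludedMiddle (lsuc lzero) →
    (p : PSym) (F V W A : Form) →
    SUBST V p F → SUBST W p F → SUBST A p F →
    (∀ j → ¬ FreeI (xs j) A) →
    (F [ p ≔ (A ∧ᶠ V) ∨ᶠ ((¬ᶠ A) ∧ᶠ W) ]) ≣ ((A ∧ᶠ (F [ p ≔ V ])) ∨ᶠ ((¬ᶠ A) ∧ᶠ (F [ p ≔ W ])))
proposition14 lem p F V W A _ _ (A-no-capture , _) xs∉A I with lem {I ⊨ A}
... | yes I⊨A = ⇔-sym (if-true-⇔ I⊨A) ⇔-∘ replace F A-no-capture (λ _ → ⇔-id _)
  where
  open Replacement p A ((A ∧ᶠ V) ∨ᶠ ((¬ᶠ A) ∧ᶠ W)) V (I ⊨ A) (λ {K} ts K⊨A⇔I⊨A →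
    if-true-⇔ (from K⊨A⇔I⊨A I⊨A) ⇔-∘ ⊨-instSub-if ts A V W xs∉A K)
... | no I⊭A = ⇔-sym (if-false-⇔ I⊭A) ⇔-∘ replace F A-no-capture (λ _ → ⇔-id _)
  where
  open Replacement p A ((A ∧ᶠ V) ∨ᶠ ((¬ᶠ A) ∧ᶠ W)) W (I ⊨ A) (λ {K} ts K⊨A⇔I⊨A →
    if-false-⇔ (I⊭A ∘ to K⊨A⇔I⊨A) ⇔-∘ ⊨-instSub-if ts A V W xs∉A K)
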